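{- Let $G=\sum_{i=1}^n G_i$ be a disjunctive sum of mis\`ere \textsc{cricket pitch} positions $G_i$, each of which is a one-bump position (a single bump of some positive size $k$ on one side of the roller, i.e. $k\circledcirc$ or $\circledcirc k$). Let $\ell$ be the number of components $G_i$ with $o(G_i)=\mathcal{L}$ and $r$ the number of components with $o(G_i)=\mathcal{R}$. Then $o(G)=\mathcal{L}$ if $\ell>r$, $o(G)=\mathcal{N}$ if $\ell=r$, and $o(G)=\mathcal{R}$ if $\ell<r$.
   Context: \textsc{cricket pitch}: a row of bumps (non-negative integers) with a roller $\circledcirc$; Left moves the roller to the left, Right moves it to the right, over any positive number of consecutive bumps, each bump rolled over being reduced by $1$; a bump of size $0$ can no longer be rolled over. In a disjunctive sum a player on their turn moves in exactly one component. Mis\`ere play: the player unable to move on their turn wins. Outcome classes: $\mathcal{L}$ (Left wins whoever moves first), $\mathcal{R}$ (Right wins whoever moves first), $\mathcal{N}$ (the player moving first wins), $\mathcal{P}$ (the player moving second wins). -}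

module Defs where

open import Data.Nat using (ℕ; zero; suc)
open import Data.List using (List; []; _∷_)
open import Data.Product using (_×_; _,_; ∃)
open import Relation.Nullary using (¬_)
open import Relation.Binary.Construct.Closure.Transitive using (TransClosure)

-- A position is a pair (L , R): L lists the bumps to the LEFT of the
-- roller, nearest to the roller first; R lists the bumps to the RIGHT
-- of the roller, nearest to the roller first.  E.g. the row
--   a b ⊚ c d   is   (b ∷ a ∷ [] , c ∷ d ∷ [])

Pos : Set
Pos = List ℕ × List ℕ

-- Rolling the roller one bump to the left / right: the bump must be
-- positive, and it is reduced by 1 (it ends up on the other side).
data LeftStep : Pos → Pos → Set where
  roll : ∀ {b L R} → LeftStep (suc b ∷ L , R) (L , b ∷ R)

data RightStep : Pos → Pos → Set where
  roll : ∀ {b L R} → RightStep (L , suc b ∷ R) (b ∷ L , R)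

-- A move: roll over a positive number of consecutive bumps.
LeftMove : Pos → Pos → Set
LeftMove = TransClosure LeftStep

RightMove : Pos → Pos → Set
RightMove = TransClosure RightStep

Game : Set
Game = List Pos

data InOne (M : Pos → Pos → Set) : Game → Game → Set where
  here  : ∀ {p p' gs} → M p p' → InOne M (p ∷ gs) (p' ∷ gs)
  there : ∀ {g gs gs'} → InOne M gs gs' → InOne M (g ∷ gs) (g ∷ gs')

LMove : Game → Game → Set
LMove = InOne LeftMove

RMove : Game → Game → Set
RMove = InOne RightMove

-- Misère play: a player unable to move on their turn wins.
-- LeftSecond G : Left wins G when Right moves first.
-- (Inductive = winning strategy; games are finite.)

mutual
  data LeftFirst (G : Game) : Set where
    stuck : (∀ {G'} → ¬ LMove G G') → LeftFirst G
    move  : ∀ {G'} → LMove G G' → LeftSecond G' → LeftFirst G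

  data LeftSecond (G : Game) : Set where
    reply : ∃ (RMove G) → (∀ {G'} → RMove G G' → LeftFirst G') → LeftSecond G

mutual
  data RightFirst (G : Game) : Set where
    stuck : (∀ {G'} → ¬ RMove G G') → RightFirst G
    move  : ∀ {G'} → RMove G G' → RightSecond G' → RightFirst G

  data RightSecond (G : Game) : Set where
    reply : ∃ (LMove G) → (∀ {G'} → LMove G G' → RightFirst G') → RightSecond G

data Outcome : Set where
  𝓛 𝓝 𝓟 𝓡 : Outcome

HasOutcome : Game → Outcome → Set
HasOutcome G 𝓛 = LeftFirst G × LeftSecond G
HasOutcome G 𝓝 = LeftFirst G × RightFirst G
HasOutcome G 𝓟 = LeftSecond G × RightSecond G
HasOutcome G 𝓡 = RightFirst G × RightSecond G

data OneBump : Pos → Set where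
  bumpLeft  : (k : ℕ) → OneBump (suc k ∷ [] , [])
  bumpRight : (k : ℕ) → OneBump ([] , suc k ∷ [])

countL : List Outcome → ℕ
countL []        = 0
countL (𝓛 ∷ os) = suc (countL os)
countL (_ ∷ os)  = countL os

countR : List Outcome → ℕ
countR []        = 0
countR (𝓡 ∷ os) = suc (countR os)
countR (_ ∷ os)  = countR os

{-# OPTIONS --safe #-}

-- Assign to k⊚ and ⊚k the outcome dictated by the parity of k, and let #𝓛,
-- #𝓡 count the components assigned 𝓛, 𝓡.  Whatever component
-- is played, a Left move raises #𝓛 − #𝓡 by exactly one and a Right move
-- lowers it by one.  So Left, moving with #𝓡 ≤ #𝓛, may play anything and
-- leaves #𝓡 < #𝓛; then some ⊚k with k odd is present, Right is not stuck,
-- and every reply restores #𝓡 ≤ #𝓛.  Symmetrically for Right.  Applied to a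
-- single component this shows that the parity outcome is its true outcome,
-- which is unique, so #𝓛 and #𝓡 are the ℓ and r of the statement.
module Submission where

open import Defs
open import Data.Nat using (ℕ; zero; suc; _+_; _≤_; _<_; _>_; s≤s; z≤n; parity)
open import Data.Nat.Properties
  using (+-suc; +-comm; n<1+n; ≤-reflexive; <-trans; <⇒≤; +-monoˡ-≤; +-monoʳ-≤; +-cancelʳ-≤;
         +-monoˡ-<; +-monoʳ-<; m<n⇒n≢0; +-commutativeSemigroup; module ≤-Reasoning)
open import Data.Nat.Induction using (<-wellFounded)
open import Data.Parity.Base using (Parity; 0ℙ; 1ℙ)
open import Data.List using (List; []; _∷_; [_]; map)
open import Data.Nat.ListAction using (sum)
open import Data.List.Relation.Unary.All as All using (All; []; _∷_)
open import Data.List.Relation.Binary.Pointwise using (Pointwise; []; _∷_)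
open import Data.Product using (_×_; _,_; ∃)
open import Data.Empty using (⊥-elim)
open import Relation.Nullary using (¬_; Dec; yes; no; contradiction)
open import Relation.Binary.PropositionalEquality using (_≡_; refl; sym; trans; cong; cong₂; module ≡-Reasoning)
open import Relation.Binary.Construct.Closure.Transitive using (TransClosure; _∷_) renaming ([_] to [_]⁺)
open import Induction.WellFounded using (Acc; acc)
open import Algebra.Properties.CommutativeSemigroup +-commutativeSemigroup using (interchange; x∙yz≈yx∙z)

total : (Pos → ℕ) → Game → ℕ
total f G = sum (map f G)

weight : Pos → ℕ
weight (L , R) = sum L + sum R

leftStep-weight : ∀ {p p'} → LeftStep p p' → weight p' < weight p
leftStep-weight {suc b ∷ L , R} roll = s≤s (≤-reflexive (x∙yz≈yx∙z (sum L) b (sum R)))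

rightStep-weight : ∀ {p p'} → RightStep p p' → weight p' < weight p
rightStep-weight {L , suc b ∷ R} roll = begin-strict
  b + sum L + sum R       ≡⟨ sym (x∙yz≈yx∙z (sum L) b (sum R)) ⟩
  sum L + (b + sum R)     <⟨ +-monoʳ-< (sum L) (n<1+n (b + sum R)) ⟩
  sum L + suc (b + sum R) ∎
  where open ≤-Reasoning

descends⁺ : ∀ {R : Pos → Pos → Set} (f : Pos → ℕ) → (∀ {p p'} → R p p' → f p' < f p) →
            ∀ {p p'} → TransClosure R p p' → f p' < f p
descends⁺ f desc [ s ]⁺    = desc s
descends⁺ f desc (s ∷ ss) = <-trans (descends⁺ f desc ss) (desc s)

inOne-descends : ∀ {M : Pos → Pos → Set} (f : Pos → ℕ) → (∀ {p p'} → M p p' → f p' < f p) →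
                 ∀ {G G'} → InOne M G G' → total f G' < total f G
inOne-descends f desc {p ∷ G} (here m)  = +-monoˡ-< (total f G) (desc m)
inOne-descends f desc {p ∷ G} (there m) = +-monoʳ-< (f p) (inOne-descends f desc m)

leftMove-weight : ∀ {G G'} → LMove G G' → total weight G' < total weight G
leftMove-weight = inOne-descends weight (descends⁺ weight leftStep-weight)

rightMove-weight : ∀ {G G'} → RMove G G' → total weight G' < total weight G
rightMove-weight = inOne-descends weight (descends⁺ weight rightStep-weight)

leftMove? : ∀ p → Dec (∃ (LeftMove p))
leftMove? (suc b ∷ L , R) = yes (_ , [ roll ]⁺)
leftMove? (zero ∷ L , R)  = no λ { (_ , [ () ]⁺) ; (_ , () ∷ _) }
leftMove? ([] , R)        = no λ { (_ , [ () ]⁺) ; (_ , () ∷ _) }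

rightMove? : ∀ p → Dec (∃ (RightMove p))
rightMove? (L , suc b ∷ R) = yes (_ , [ roll ]⁺)
rightMove? (L , zero ∷ R)  = no λ { (_ , [ () ]⁺) ; (_ , () ∷ _) }
rightMove? (L , [])        = no λ { (_ , [ () ]⁺) ; (_ , () ∷ _) }

inOne? : ∀ {M : Pos → Pos → Set} → (∀ p → Dec (∃ (M p))) → ∀ G → Dec (∃ (InOne M G))
inOne? M? []      = no λ ()
inOne? M? (p ∷ G) with M? p | inOne? M? G
... | yes (_ , m) | _           = yes (_ , here m)
... | no _        | yes (_ , m) = yes (_ , there m)
... | no ¬m       | no ¬ms      = no λ { (_ , here m) → ¬m (_ , m) ; (_ , there m) → ¬ms (_ , m) }

mutual
  leftFirst⇒¬rightSecond : ∀ {G} → LeftFirst G → ¬ RightSecond G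
  leftFirst⇒¬rightSecond (stuck ¬m)  (reply (_ , m) _) = ¬m m
  leftFirst⇒¬rightSecond (move m ls) (reply _ rf)      = leftSecond⇒¬rightFirst ls (rf m)

  leftSecond⇒¬rightFirst : ∀ {G} → LeftSecond G → ¬ RightFirst G
  leftSecond⇒¬rightFirst (reply (_ , m) _) (stuck ¬m)  = ¬m m
  leftSecond⇒¬rightFirst (reply _ lf)      (move m rs) = leftFirst⇒¬rightSecond (lf m) rs

outcome-unique : ∀ {G} o o' → HasOutcome G o → HasOutcome G o' → o ≡ o'
outcome-unique 𝓛 𝓛 _ _               = refl
outcome-unique 𝓛 𝓝 (_ , ls) (_ , rf) = ⊥-elim (leftSecond⇒¬rightFirst ls rf)
outcome-unique 𝓛 𝓟 (lf , _) (_ , rs) = ⊥-elim (leftFirst⇒¬rightSecond lf rs)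
outcome-unique 𝓛 𝓡 (lf , _) (_ , rs) = ⊥-elim (leftFirst⇒¬rightSecond lf rs)
outcome-unique 𝓝 𝓛 (_ , rf) (_ , ls) = ⊥-elim (leftSecond⇒¬rightFirst ls rf)
outcome-unique 𝓝 𝓝 _ _               = refl
outcome-unique 𝓝 𝓟 (lf , _) (_ , rs) = ⊥-elim (leftFirst⇒¬rightSecond lf rs)
outcome-unique 𝓝 𝓡 (lf , _) (_ , rs) = ⊥-elim (leftFirst⇒¬rightSecond lf rs)
outcome-unique 𝓟 𝓛 (_ , rs) (lf , _) = ⊥-elim (leftFirst⇒¬rightSecond lf rs)
outcome-unique 𝓟 𝓝 (_ , rs) (lf , _) = ⊥-elim (leftFirst⇒¬rightSecond lf rs)
outcome-unique 𝓟 𝓟 _ _               = refl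
outcome-unique 𝓟 𝓡 (ls , _) (rf , _) = ⊥-elim (leftSecond⇒¬rightFirst ls rf)
outcome-unique 𝓡 𝓛 (_ , rs) (lf , _) = ⊥-elim (leftFirst⇒¬rightSecond lf rs)
outcome-unique 𝓡 𝓝 (_ , rs) (lf , _) = ⊥-elim (leftFirst⇒¬rightSecond lf rs)
outcome-unique 𝓡 𝓟 (rf , _) (ls , _) = ⊥-elim (leftSecond⇒¬rightFirst ls rf)
outcome-unique 𝓡 𝓡 _ _               = refl

countL-∷ : ∀ o os → countL (o ∷ os) ≡ countL [ o ] + countL os
countL-∷ 𝓛 os = refl
countL-∷ 𝓝 os = refl
countL-∷ 𝓟 os = refl
countL-∷ 𝓡 os = refl

countR-∷ : ∀ o os → countR (o ∷ os) ≡ countR [ o ] + countR os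
countR-∷ 𝓛 os = refl
countR-∷ 𝓝 os = refl
countR-∷ 𝓟 os = refl
countR-∷ 𝓡 os = refl

countL-map : ∀ (f : Pos → Outcome) G → countL (map f G) ≡ total (λ p → countL [ f p ]) G
countL-map f []      = refl
countL-map f (p ∷ G) = trans (countL-∷ (f p) (map f G)) (cong (countL [ f p ] +_) (countL-map f G))

countR-map : ∀ (f : Pos → Outcome) G → countR (map f G) ≡ total (λ p → countR [ f p ]) G
countR-map f []      = refl
countR-map f (p ∷ G) = trans (countR-∷ (f p) (map f G)) (cong (countR [ f p ] +_) (countR-map f G))

-- a' − b' = (a − b) + 1, stated without truncated subtraction.
Rise : ℕ × ℕ → ℕ × ℕ → Set
Rise (a , b) (a' , b') = a' + b ≡ suc (a + b')

rise⇒< : ∀ {a b a' b'} → Rise (a , b) (a' , b') → b ≤ a → b' < a'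
rise⇒< {a} {b} {a'} {b'} eq b≤a = +-cancelʳ-≤ a (suc b') a' (begin
  suc b' + a    ≡⟨ cong suc (+-comm b' a) ⟩
  suc (a + b')  ≡⟨ sym eq ⟩
  a' + b        ≤⟨ +-monoʳ-≤ a' b≤a ⟩
  a' + a        ∎)
  where open ≤-Reasoning

rise⇒≤ : ∀ {a b a' b'} → Rise (a , b) (a' , b') → a < b → a' ≤ b'
rise⇒≤ {a} {b} {a'} {b'} eq a<b = +-cancelʳ-≤ b a' b' (begin
  a' + b        ≡⟨ eq ⟩
  suc a + b'    ≤⟨ +-monoˡ-≤ b' a<b ⟩
  b + b'        ≡⟨ +-comm b b' ⟩
  b' + b        ∎)
  where open ≤-Reasoning

rise-+ʳ : ∀ {a b a' b'} c d → Rise (a , b) (a' , b') → Rise (a + c , b + d) (a' + c , b' + d)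
rise-+ʳ {a} {b} {a'} {b'} c d eq = begin
  a' + c + (b + d)       ≡⟨ interchange a' c b d ⟩
  a' + b + (c + d)       ≡⟨ cong (_+ (c + d)) eq ⟩
  suc (a + b' + (c + d)) ≡⟨ cong suc (interchange a b' c d) ⟩
  suc (a + c + (b' + d)) ∎
  where open ≡-Reasoning

rise-+ˡ : ∀ {a b a' b'} c d → Rise (a , b) (a' , b') → Rise (c + a , d + b) (c + a' , d + b')
rise-+ˡ {a} {b} {a'} {b'} c d eq = begin
  c + a' + (d + b)       ≡⟨ interchange c a' d b ⟩
  c + d + (a' + b)       ≡⟨ cong (c + d +_) eq ⟩
  c + d + suc (a + b')   ≡⟨ +-suc (c + d) (a + b') ⟩
  suc (c + d + (a + b')) ≡⟨ cong suc (interchange c d a b') ⟩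
  suc (c + a + (d + b')) ∎
  where open ≡-Reasoning

inOne-rise : ∀ {P : Pos → Set} {M : Pos → Pos → Set} (f g : Pos → ℕ) →
             (∀ {p p'} → P p → M p p' → P p' × Rise (f p , g p) (f p' , g p')) →
             ∀ {G G'} → All P G → InOne M G G' →
             All P G' × Rise (total f G , total g G) (total f G' , total g G')
inOne-rise f g step {p ∷ G} {p' ∷ _} (x ∷ xs) (here m) =
  let x' , rise = step x m
  in x' ∷ xs , rise-+ʳ {f p} {g p} {f p'} {g p'} (total f G) (total g G) rise
inOne-rise f g step {p ∷ G} {_ ∷ G'} (x ∷ xs) (there m) =
  let xs' , rise = inOne-rise f g step xs m
  in x ∷ xs' , rise-+ˡ {total f G} {total g G} {total f G'} {total g G'} (f p) (g p) rise

total-stuck : ∀ {P : Pos → Set} {M : Pos → Pos → Set} (f : Pos → ℕ) →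
              (∀ {p} → P p → ¬ ∃ (M p) → f p ≡ 0) →
              ∀ {G} → All P G → ¬ ∃ (InOne M G) → total f G ≡ 0
total-stuck f zero-if-stuck []       _  = refl
total-stuck f zero-if-stuck (x ∷ xs) ¬m =
  cong₂ _+_ (zero-if-stuck x λ (_ , m) → ¬m (_ , here m))
            (total-stuck f zero-if-stuck xs λ (_ , m) → ¬m (_ , there m))

data Bump : Pos → Set where
  _⊚ : ∀ k → Bump (k ∷ [] , [])
  ⊚_ : ∀ k → Bump ([] , k ∷ [])

oneBump⇒bump : ∀ {p} → OneBump p → Bump p
oneBump⇒bump (bumpLeft k)  = suc k ⊚
oneBump⇒bump (bumpRight k) = ⊚ suc k

whenOdd : Parity → Outcome → Outcome
whenOdd 0ℙ _ = 𝓝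
whenOdd 1ℙ o = o

-- k⊚ is a chain of k alternating moves, Left's first; in misère play the
-- player facing the exhausted chain wins, so Right wins if k is odd and
-- the first player wins otherwise.
bumpOutcome : Pos → Outcome
bumpOutcome (k ∷ [] , []) = whenOdd (parity k) 𝓡
bumpOutcome ([] , k ∷ []) = whenOdd (parity k) 𝓛
bumpOutcome _             = 𝓝

countLᵖ countRᵖ : Pos → ℕ
countLᵖ p = countL [ bumpOutcome p ]
countRᵖ p = countR [ bumpOutcome p ]

#𝓛 #𝓡 : Game → ℕ
#𝓛 = total countLᵖ
#𝓡 = total countRᵖ

leftRoll-rise : ∀ k → Rise (countLᵖ (suc k ∷ [] , []) , countRᵖ (suc k ∷ [] , []))
                           (countLᵖ ([] , k ∷ []) , countRᵖ ([] , k ∷ []))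
leftRoll-rise 0             = refl
leftRoll-rise 1             = refl
leftRoll-rise (suc (suc k)) = leftRoll-rise k

rightRoll-rise : ∀ k → Rise (countRᵖ ([] , suc k ∷ []) , countLᵖ ([] , suc k ∷ []))
                            (countRᵖ (k ∷ [] , []) , countLᵖ (k ∷ [] , []))
rightRoll-rise 0             = refl
rightRoll-rise 1             = refl
rightRoll-rise (suc (suc k)) = rightRoll-rise k

bump-leftMove-rise : ∀ {p p'} → Bump p → LeftMove p p' →
                     Bump p' × Rise (countLᵖ p , countRᵖ p) (countLᵖ p' , countRᵖ p')
bump-leftMove-rise (_ ⊚) [ roll {k} ]⁺ = ⊚ k , leftRoll-rise k
bump-leftMove-rise (_ ⊚) (roll ∷ [ () ]⁺)
bump-leftMove-rise (_ ⊚) (roll ∷ () ∷ _)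
bump-leftMove-rise (⊚ _) [ () ]⁺
bump-leftMove-rise (⊚ _) (() ∷ _)

bump-rightMove-rise : ∀ {p p'} → Bump p → RightMove p p' →
                      Bump p' × Rise (countRᵖ p , countLᵖ p) (countRᵖ p' , countLᵖ p')
bump-rightMove-rise (⊚ _) [ roll {k} ]⁺ = k ⊚ , rightRoll-rise k
bump-rightMove-rise (⊚ _) (roll ∷ [ () ]⁺)
bump-rightMove-rise (⊚ _) (roll ∷ () ∷ _)
bump-rightMove-rise (_ ⊚) [ () ]⁺
bump-rightMove-rise (_ ⊚) (() ∷ _)

bump-leftStuck : ∀ {p} → Bump p → ¬ ∃ (LeftMove p) → countRᵖ p ≡ 0
bump-leftStuck (zero ⊚)  _  = refl
bump-leftStuck (suc k ⊚) ¬m = contradiction (_ , [ roll ]⁺) ¬m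
bump-leftStuck (⊚ k)     _ with parity k
... | 0ℙ = refl
... | 1ℙ = refl

bump-rightStuck : ∀ {p} → Bump p → ¬ ∃ (RightMove p) → countLᵖ p ≡ 0
bump-rightStuck (⊚ zero)  _  = refl
bump-rightStuck (⊚ suc k) ¬m = contradiction (_ , [ roll ]⁺) ¬m
bump-rightStuck (k ⊚)     _ with parity k
... | 0ℙ = refl
... | 1ℙ = refl

leftMove-rise : ∀ {G G'} → All Bump G → LMove G G' →
                All Bump G' × Rise (#𝓛 G , #𝓡 G) (#𝓛 G' , #𝓡 G')
leftMove-rise = inOne-rise countLᵖ countRᵖ bump-leftMove-rise

rightMove-rise : ∀ {G G'} → All Bump G → RMove G G' →
                 All Bump G' × Rise (#𝓡 G , #𝓛 G) (#𝓡 G' , #𝓛 G')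
rightMove-rise = inOne-rise countRᵖ countLᵖ bump-rightMove-rise

leftMove-exists : ∀ {G} → All Bump G → #𝓛 G < #𝓡 G → ∃ (LMove G)
leftMove-exists {G} bs ℓ<r with inOne? leftMove? G
... | yes m = m
... | no ¬m = contradiction (total-stuck countRᵖ bump-leftStuck bs ¬m) (m<n⇒n≢0 ℓ<r)

rightMove-exists : ∀ {G} → All Bump G → #𝓡 G < #𝓛 G → ∃ (RMove G)
rightMove-exists {G} bs r<ℓ with inOne? rightMove? G
... | yes m = m
... | no ¬m = contradiction (total-stuck countLᵖ bump-rightStuck bs ¬m) (m<n⇒n≢0 r<ℓ)

mutual
  leftFirst : ∀ {G} → All Bump G → #𝓡 G ≤ #𝓛 G → Acc _<_ (total weight G) → LeftFirst G
  leftFirst {G} bs r≤ℓ (acc rec) with inOne? leftMove? G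
  ... | no ¬m       = stuck λ m → ¬m (_ , m)
  ... | yes (_ , m) =
    let bs' , rise = leftMove-rise bs m
    in move m (leftSecond bs' (rise⇒< rise r≤ℓ) (rec (leftMove-weight m)))

  leftSecond : ∀ {G} → All Bump G → #𝓡 G < #𝓛 G → Acc _<_ (total weight G) → LeftSecond G
  leftSecond bs r<ℓ (acc rec) = reply (rightMove-exists bs r<ℓ) λ m →
    let bs' , rise = rightMove-rise bs m
    in leftFirst bs' (rise⇒≤ rise r<ℓ) (rec (rightMove-weight m))

mutual
  rightFirst : ∀ {G} → All Bump G → #𝓛 G ≤ #𝓡 G → Acc _<_ (total weight G) → RightFirst G
  rightFirst {G} bs ℓ≤r (acc rec) with inOne? rightMove? G
  ... | no ¬m       = stuck λ m → ¬m (_ , m)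
  ... | yes (_ , m) =
    let bs' , rise = rightMove-rise bs m
    in move m (rightSecond bs' (rise⇒< rise ℓ≤r) (rec (rightMove-weight m)))

  rightSecond : ∀ {G} → All Bump G → #𝓛 G < #𝓡 G → Acc _<_ (total weight G) → RightSecond G
  rightSecond bs ℓ<r (acc rec) = reply (leftMove-exists bs ℓ<r) λ m →
    let bs' , rise = leftMove-rise bs m
    in rightFirst bs' (rise⇒≤ rise ℓ<r) (rec (leftMove-weight m))

bumpGame-outcome : ∀ {G} → All Bump G →
  (#𝓛 G > #𝓡 G → HasOutcome G 𝓛) ×
  (#𝓛 G ≡ #𝓡 G → HasOutcome G 𝓝) ×
  (#𝓛 G < #𝓡 G → HasOutcome G 𝓡)
bumpGame-outcome {G} bs =
  (λ r<ℓ → leftFirst bs (<⇒≤ r<ℓ) wf , leftSecond bs r<ℓ wf) ,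
  (λ ℓ≡r → leftFirst bs (≤-reflexive (sym ℓ≡r)) wf , rightFirst bs (≤-reflexive ℓ≡r) wf) ,
  (λ ℓ<r → rightFirst bs (<⇒≤ ℓ<r) wf , rightSecond bs ℓ<r wf)
  where
  wf : Acc _<_ (total weight G)
  wf = <-wellFounded (total weight G)

bump-outcome : ∀ {p} → Bump p → HasOutcome [ p ] (bumpOutcome p)
bump-outcome (k ⊚) with parity k | bumpGame-outcome (k ⊚ ∷ [])
... | 0ℙ | _ , tie , _        = tie refl
... | 1ℙ | _ , _ , rightAhead = rightAhead (s≤s z≤n)
bump-outcome (⊚ k) with parity k | bumpGame-outcome (⊚ k ∷ [])
... | 0ℙ | _ , tie , _       = tie refl
... | 1ℙ | leftAhead , _ , _ = leftAhead (s≤s z≤n)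

pointwise-outcomes : ∀ {G os} → All Bump G → Pointwise (λ p o → HasOutcome [ p ] o) G os →
                     os ≡ map bumpOutcome G
pointwise-outcomes []       []       = refl
pointwise-outcomes (b ∷ bs) (h ∷ hs) =
  cong₂ _∷_ (outcome-unique _ _ h (bump-outcome b)) (pointwise-outcomes bs hs)

theorem9 : (G : Game) → All OneBump G →
    (os : List Outcome) → Pointwise (λ Gi o → HasOutcome [ Gi ] o) G os →
    (countL os > countR os → HasOutcome G 𝓛) ×
    (countL os ≡ countR os → HasOutcome G 𝓝) ×
    (countL os < countR os → HasOutcome G 𝓡)
theorem9 G obs os hs with All.map oneBump⇒bump obs
... | bs rewrite pointwise-outcomes bs hs | countL-map bumpOutcome G | countR-map bumpOutcome G =
  bumpGame-outcome bs
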